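{- Let $\pi=\pi_1\cdots\pi_n$ be a permutation of $\{1,\dots,n\}$ and let $P$ be its Schröder insertion tableau. Then $P$ consists of a single row if and only if, for all $i$ with $1\le i\le n$: (1) if $i$ is odd, then $\pi_i$ is a left-to-right maximum of $\pi$; (2) if $i$ is even, then $\pi_i$ is a left-to-right maximum of the permutation obtained from $\pi$ by removing $\pi_{i-1}$ (and standardizing the remaining entries), i.e. $\pi_i>\pi_j$ for all $j<i$ with $j\neq i-1$.
   Context: $\pi_i$ is a left-to-right maximum of $\pi$ if $\pi_i=\max(\pi_1,\dots,\pi_i)$. A (partial) Schröder tableau is stored as a sequence of rows; row $r$ is a sequence of cells at positions $1,2,\dots,\ell_r$, each containing a number; the cell at an odd position is an upper triangle and the cell at an even position is a lower triangle (positions $2c-1$ and $2c$ form the two halves of one square). Schröder insertion of a number $\alpha$ into a tableau $P$: set $i=1$ and repeat: if row $i$ does not exist or $\alpha$ exceeds every entry of row $i$, append a new cell containing $\alpha$ at the end of row $i$ (creating the row if needed) and stop. Otherwise let $j$ be the position in row $i$ of the smallest entry $\gamma>\alpha$. If $j$ is even (lower triangle), write $\alpha$ in position $j$, set $\alpha:=\gamma$, $i:=i+1$ and repeat. If $j$ is odd (upper triangle) and $j$ is the last position of row $i$, write $\alpha$ in position $j$, append a new cell at position $j+1$ containing $\gamma$, and stop. If $j$ is odd and not last, let $\beta$ be the entry at position $j+1$; write $\alpha$ at position $j$ and $\gamma$ at position $j+1$, set $\alpha:=\beta$, $i:=i+1$ and repeat. The Schröder insertion tableau of $\pi$ is obtained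 by starting from the tableau with a single row consisting of one cell containing $\pi_1$ and successively inserting $\pi_2,\dots,\pi_n$. -}

module Defs where

open import Data.Nat using (ℕ; zero; suc; _+_; _<_; _≤_; _<ᵇ_; _≡ᵇ_; _%_; _∸_)
open import Data.Nat.Base using (_⊓_)
open import Data.Bool using (Bool; true; false; if_then_else_)
open import Data.List using (List; []; _∷_; _++_; [_]; length; foldl)
open import Data.Maybe using (Maybe; just; nothing)
open import Data.Product using (_×_; _,_)

-- A (partial) Schröder tableau: a list of rows; a row is a list of entries,
-- position p (1-based) in a row is an upper triangle if p is odd, a lower
-- triangle if p is even.
Row : Set
Row = List ℕ

Tableau : Set
Tableau = List Row

minAbove : ℕ → Row → Maybe ℕ
minAbove α [] = nothing
minAbove α (x ∷ xs) with α <ᵇ x | minAbove α xs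
... | true  | nothing = just x
... | true  | just m  = just (x ⊓ m)
... | false | r       = r

-- 1-based position of the first occurrence of γ in a row (0 if absent)
posOf : ℕ → Row → ℕ
posOf γ [] = 0
posOf γ (x ∷ xs) with γ ≡ᵇ x
... | true  = 1
... | false with posOf γ xs
...   | zero  = 0
...   | suc p = suc (suc p)

setAt : ℕ → ℕ → Row → Row
setAt p v [] = []
setAt zero v (x ∷ xs) = x ∷ xs
setAt (suc zero) v (x ∷ xs) = v ∷ xs
setAt (suc (suc p)) v (x ∷ xs) = x ∷ setAt (suc p) v xs

-- entry at 1-based position p (0 if absent)
getAt : ℕ → Row → ℕ
getAt p [] = 0
getAt zero (x ∷ xs) = 0
getAt (suc zero) (x ∷ xs) = x
getAt (suc (suc p)) (x ∷ xs) = getAt (suc p) xs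

isEven : ℕ → Bool
isEven n = n % 2 ≡ᵇ 0

-- One step of Schröder insertion of α into a row: returns the new row and
-- the number bumped to the next row (nothing = stop).
rowInsert : ℕ → Row → Row × Maybe ℕ
rowInsert α r with minAbove α r
... | nothing = r ++ [ α ] , nothing
... | just γ with posOf γ r
...   | j with isEven j
...     | true  = setAt j α r , just γ
...     | false with j ≡ᵇ length r
...       | true  = setAt j α r ++ [ γ ] , nothing
...       | false = setAt (suc j) γ (setAt j α r) , just (getAt (suc j) r)

schroderInsert : ℕ → Tableau → Tableau
schroderInsert α [] = [ α ] ∷ []
schroderInsert α (r ∷ rs) with rowInsert α r
... | r' , nothing = r' ∷ rs
... | r' , just β  = r' ∷ schroderInsert β rs

-- Schröder insertion tableau of a word π₁⋯πₙ: start from the one-cell tableau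
-- [π₁] (= inserting π₁ into the empty tableau), then insert π₂,…,πₙ.
schroderP : List ℕ → Tableau
schroderP π = foldl (λ P a → schroderInsert a P) [] π

module Submission where

-- While the tableau is one row, that row is the increasing arrangement of
-- the letters read so far and, after an odd number of letters, it ends with
-- the latest letter (`SingleRow`).  Inserting a letter α into an increasing
-- row stays inside the row in exactly two ways (`Stop`): α exceeds every
-- entry, or the smallest entry above α is the last one and sits in an upper
-- triangle.  Under the invariant these two cases are precisely the
-- condition `Good` of the theorem for α, so reading a word keeps one row iff
-- each letter is good when read (`readWord`); once a second row appears it
-- never disappears.

open import Defs
open import Data.Nat using (ℕ; zero; suc; _+_; _<_; _≤_; _%_; _∸_; _<ᵇ_; _≡ᵇ_; z≤n; s≤s)
open import Data.Nat.Properties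
  using (<ᵇ⇒<; <⇒<ᵇ; ≡ᵇ⇒≡; ≡⇒≡ᵇ; ≤∧≢⇒<; ≮⇒≥; <⇒≤; <⇒≱; <⇒≢; <-asym; <-irrefl; <-trans;
         <-≤-trans; <-cmp; ≤-refl; ≤-trans; ⊓-sel; m⊓n≤m; m⊓n≤n; m≤n⇒m⊓n≡m; m≤n⇒m<n∨m≡n;
         m∸n≤m; +-comm; suc-injective; 0≢1+n; 1+n≢0)
open import Data.Bool using (true; false; not; T)
open import Data.Bool.Properties using (T-≡)
open import Data.List using (List; []; _∷_; _++_; [_]; length; foldl; take; drop; lookup; _ʳ++_; map; upTo)
open import Data.List.Properties
  using (length-++; length-take; length-reverse; length-map; length-upTo; ++-assoc; ++-identityʳ;
         ∷ʳ-injective)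
open import Data.Fin using (Fin; zero; suc; toℕ)
open import Data.Fin.Properties using (toℕ<n; toℕ-injective)
open import Data.Maybe using (just; nothing)
open import Data.Product using (_×_; _,_; proj₁; proj₂; ∃-syntax)
open import Data.Empty using (⊥; ⊥-elim)
open import Data.Unit using (⊤; tt)
open import Data.Sum using (inj₁; inj₂)
open import Relation.Binary.Definitions using (tri<; tri≈; tri>)
open import Relation.Binary.PropositionalEquality
  using (_≡_; _≢_; refl; sym; trans; cong; subst; setoid; module ≡-Reasoning)
open import Function.Bundles using (_⇔_; mk⇔; Equivalence)
open import Function.Properties.Equivalence using () renaming (trans to ⇔-trans)
open import Data.List.Relation.Unary.All as All using (All; []; _∷_)
open import Data.List.Relation.Unary.All.Properties as AllProps using (All¬⇒¬Any; drop⁺)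
open import Data.List.Relation.Unary.Any using (here; there)
open import Data.List.Relation.Unary.AllPairs using (AllPairs; []; _∷_)
import Data.List.Relation.Unary.AllPairs.Properties as AllPairs
open import Data.List.Membership.Propositional using (_∈_; _∉_)
open import Data.List.Membership.Propositional.Properties using (∈-++⁺ˡ)
open import Data.List.Relation.Binary.Permutation.Propositional
  using (_↭_; ↭-refl; ↭-sym; ↭-trans; ↭-prep; ↭⇒↭ₛ; module PermutationReasoning)
open import Data.List.Relation.Binary.Permutation.Propositional.Properties
  using (All-resp-↭; ∈-resp-↭; ↭-length; ↭-reverse; drop-mid; shift; ∷↭∷ʳ; ++-comm)
import Data.List.Relation.Binary.Permutation.Setoid.Properties as PermSetoid
open import Data.List.Relation.Unary.Unique.Propositional using (Unique)
import Data.List.Relation.Unary.Unique.Propositional.Properties as Unique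

true⇒T : ∀ {b} → b ≡ true → T b
true⇒T = Equivalence.from T-≡

true≢false : true ≢ false
true≢false ()

isEven-suc : ∀ n → isEven (suc n) ≡ not (isEven n)
isEven-suc zero          = refl
isEven-suc (suc zero)    = refl
isEven-suc (suc (suc n)) = isEven-suc n

minAbove-nothing⁻ : ∀ α r → minAbove α r ≡ nothing → All (_≤ α) r
minAbove-nothing⁻ α []      _  = []
minAbove-nothing⁻ α (x ∷ r) eq with α <ᵇ x in α<ᵇx | minAbove α r in rest
minAbove-nothing⁻ α (x ∷ r) () | true  | nothing
minAbove-nothing⁻ α (x ∷ r) () | true  | just _
minAbove-nothing⁻ α (x ∷ r) eq | false | _ =
  ≮⇒≥ (λ α<x → subst T α<ᵇx (<⇒<ᵇ α<x)) ∷ minAbove-nothing⁻ α r (trans rest eq)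

minAbove-nothing⁺ : ∀ {α r} → All (_< α) r → minAbove α r ≡ nothing
minAbove-nothing⁺ []                    = refl
minAbove-nothing⁺ {α} {x ∷ r} (x<α ∷ h) with α <ᵇ x in α<ᵇx | minAbove α r | minAbove-nothing⁺ h
... | true  | _ | _  = ⊥-elim (<-asym x<α (<ᵇ⇒< α x (true⇒T α<ᵇx)))
... | false | _ | ih = ih

minAbove-just⁻ : ∀ α r {γ} → minAbove α r ≡ just γ →
                 γ ∈ r × α < γ × All (λ x → α < x → γ ≤ x) r
minAbove-just⁻ α (x ∷ r) eq with α <ᵇ x in α<ᵇx | minAbove α r in rest
minAbove-just⁻ α (x ∷ r) refl | true | nothing =
  here refl , <ᵇ⇒< α x (true⇒T α<ᵇx) ,
  (λ _ → ≤-refl) ∷ All.map (λ y≤α α<y → ⊥-elim (<⇒≱ α<y y≤α)) (minAbove-nothing⁻ α r rest)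
minAbove-just⁻ α (x ∷ r) refl | true | just m with minAbove-just⁻ α r rest
... | m∈r , α<m , minimal with ⊓-sel x m
...   | inj₁ x⊓m≡x = subst (_∈ x ∷ r) (sym x⊓m≡x) (here refl) ,
                     subst (α <_) (sym x⊓m≡x) (<ᵇ⇒< α x (true⇒T α<ᵇx)) ,
                     (λ _ → m⊓n≤m x m) ∷ All.map (λ m≤ α<y → ≤-trans (m⊓n≤n x m) (m≤ α<y)) minimal
...   | inj₂ x⊓m≡m = subst (_∈ x ∷ r) (sym x⊓m≡m) (there m∈r) ,
                     subst (α <_) (sym x⊓m≡m) α<m ,
                     (λ _ → m⊓n≤m x m) ∷ All.map (λ m≤ α<y → ≤-trans (m⊓n≤n x m) (m≤ α<y)) minimal
minAbove-just⁻ α (x ∷ r) eq | false | _ with minAbove-just⁻ α r (trans rest eq)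
... | γ∈r , α<γ , minimal =
  there γ∈r , α<γ , (λ α<x → ⊥-elim (subst T α<ᵇx (<⇒<ᵇ α<x))) ∷ minimal

minAbove-snoc : ∀ {α ys b} → All (_< α) ys → α < b → minAbove α (ys ++ [ b ]) ≡ just b
minAbove-snoc {α} {[]} {b} [] α<b with α <ᵇ b in α<ᵇb
... | true  = refl
... | false = ⊥-elim (subst T α<ᵇb (<⇒<ᵇ α<b))
minAbove-snoc {α} {y ∷ ys} {b} (y<α ∷ h) α<b
  with α <ᵇ y in α<ᵇy | minAbove α (ys ++ [ b ]) | minAbove-snoc h α<b
... | true  | _ | _  = ⊥-elim (<-asym y<α (<ᵇ⇒< α y (true⇒T α<ᵇy)))
... | false | _ | ih = ih

length-snoc : ∀ (ys : List ℕ) b → length (ys ++ [ b ]) ≡ suc (length ys)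
length-snoc ys b = trans (length-++ ys) (+-comm (length ys) 1)

posOf-snoc : ∀ {b} ys → b ∉ ys → posOf b (ys ++ [ b ]) ≡ suc (length ys)
posOf-snoc {b} [] _ with b ≡ᵇ b in b≡ᵇb
... | true  = refl
... | false = ⊥-elim (subst T b≡ᵇb (≡⇒≡ᵇ b b refl))
posOf-snoc {b} (y ∷ ys) b∉ with b ≡ᵇ y in b≡ᵇy
... | true  = ⊥-elim (b∉ (here (≡ᵇ⇒≡ b y (true⇒T b≡ᵇy))))
... | false rewrite posOf-snoc ys (λ b∈ → b∉ (there b∈)) = refl

posOf-last⁻ : ∀ {γ} r → γ ∈ r → posOf γ r ≡ length r → ∃[ ys ] r ≡ ys ++ [ γ ]
posOf-last⁻ {γ} (x ∷ r) γ∈ eq with γ ≡ᵇ x in γ≡ᵇx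
posOf-last⁻ {γ} (x ∷ []) γ∈ eq | true
  rewrite ≡ᵇ⇒≡ γ x (true⇒T γ≡ᵇx) = [] , refl
posOf-last⁻ {γ} (x ∷ _ ∷ _) γ∈ () | true
... | false with posOf γ r in pos | γ∈
...   | zero  | _ = ⊥-elim (0≢1+n eq)
...   | suc p | here γ≡x = ⊥-elim (subst T γ≡ᵇx (≡⇒≡ᵇ γ x γ≡x))
...   | suc p | there γ∈r with posOf-last⁻ r γ∈r (trans pos (suc-injective eq))
...     | ys , refl = x ∷ ys , refl

setAt-snoc : ∀ ys (a b : ℕ) → setAt (suc (length ys)) a (ys ++ [ b ]) ≡ ys ++ [ a ]
setAt-snoc []       a b = refl
setAt-snoc (y ∷ ys) a b = cong (y ∷_) (setAt-snoc ys a b)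

sorted-snoc⁻ : ∀ {b} ys → AllPairs _<_ (ys ++ [ b ]) → AllPairs _<_ ys × All (_< b) ys
sorted-snoc⁻ []       _ = [] , []
sorted-snoc⁻ (y ∷ ys) (y< ∷ sorted) with sorted-snoc⁻ ys sorted
... | ys-sorted , ys<b =
  AllProps.++⁻ˡ ys y< ∷ ys-sorted , All.head (AllProps.++⁻ʳ ys y<) ∷ ys<b

-- The two ways inserting α into a row can end inside that row: α exceeds
-- every entry and is appended, or the smallest entry above α is the last
-- entry b, sitting in an upper triangle (odd position), and α takes b's place
-- while b moves into the new lower triangle.
data Stop (α : ℕ) : Row → Row → Set where
  above     : ∀ {r} → All (_< α) r → Stop α r (r ++ [ α ])
  belowLast : ∀ {ys b} → All (_< α) ys → α < b → isEven (length (ys ++ [ b ])) ≡ false →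
              Stop α (ys ++ [ b ]) ((ys ++ [ α ]) ++ [ b ])

rowInsert-lastCell : ∀ α r {γ} → minAbove α r ≡ just γ → posOf γ r ≡ length r →
                     isEven (length r) ≡ false →
                     rowInsert α r ≡ (setAt (length r) α r ++ [ γ ] , nothing)
rowInsert-lastCell α r minAbove≡γ pos odd
  rewrite minAbove≡γ | pos | odd | Equivalence.to T-≡ (≡⇒≡ᵇ (length r) (length r) refl) = refl

stop-sound : ∀ {α r r'} → Stop α r r' → rowInsert α r ≡ (r' , nothing)
stop-sound (above r<α) rewrite minAbove-nothing⁺ r<α = refl
stop-sound {α} (belowLast {ys} {b} ys<α α<b odd) = begin
  rowInsert α (ys ++ [ b ])
    ≡⟨ rowInsert-lastCell α (ys ++ [ b ]) (minAbove-snoc ys<α α<b) pos odd ⟩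
  (setAt (length (ys ++ [ b ])) α (ys ++ [ b ]) ++ [ b ] , nothing)
    ≡⟨ cong (λ row → row ++ [ b ] , nothing) overwrite ⟩
  ((ys ++ [ α ]) ++ [ b ] , nothing) ∎
  where
  open ≡-Reasoning
  b∉ys : b ∉ ys
  b∉ys b∈ys = <-irrefl refl (<-trans (All.lookup ys<α b∈ys) α<b)
  pos : posOf b (ys ++ [ b ]) ≡ length (ys ++ [ b ])
  pos = trans (posOf-snoc ys b∉ys) (sym (length-snoc ys b))
  overwrite : setAt (length (ys ++ [ b ])) α (ys ++ [ b ]) ≡ ys ++ [ α ]
  overwrite = subst (λ k → setAt k α (ys ++ [ b ]) ≡ ys ++ [ α ])
                    (sym (length-snoc ys b)) (setAt-snoc ys α b)

strictly-below : ∀ {α r} → α ∉ r → All (_≤ α) r → All (_< α) r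
strictly-below α∉ []          = []
strictly-below α∉ (x≤α ∷ r≤α) =
  ≤∧≢⇒< x≤α (λ x≡α → α∉ (here (sym x≡α))) ∷ strictly-below (λ α∈ → α∉ (there α∈)) r≤α

stop-complete : ∀ {α r r'} → AllPairs _<_ r → α ∉ r → rowInsert α r ≡ (r' , nothing) → Stop α r r'
stop-complete {α} {r} sorted α∉ eq with minAbove α r in minAbove≡
stop-complete {α} {r} sorted α∉ refl | nothing =
  above (strictly-below α∉ (minAbove-nothing⁻ α r minAbove≡))
... | just γ with isEven (posOf γ r) in parity
stop-complete sorted α∉ () | just γ | true
... | false with posOf γ r ≡ᵇ length r in atEnd
stop-complete sorted α∉ () | just γ | false | false
stop-complete {α} {r} sorted α∉ refl | just γ | false | true
  with minAbove-just⁻ α r minAbove≡ | ≡ᵇ⇒≡ (posOf γ r) (length r) (true⇒T atEnd)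
... | γ∈r , α<γ , minimal | pos with posOf-last⁻ r γ∈r pos
...   | ys , refl =
  subst (Stop α (ys ++ [ γ ])) (cong (_++ [ γ ]) (sym overwrite))
        (belowLast ys<α α<γ (subst (λ k → isEven k ≡ false) pos parity))
  where
  overwrite : setAt (posOf γ (ys ++ [ γ ])) α (ys ++ [ γ ]) ≡ ys ++ [ α ]
  overwrite = trans (cong (λ k → setAt k α (ys ++ [ γ ])) (trans pos (length-snoc ys γ)))
                    (setAt-snoc ys α γ)
  ys<γ : All (_< γ) ys
  ys<γ = proj₂ (sorted-snoc⁻ ys sorted)
  ys<α : All (_< α) ys
  ys<α = strictly-below (λ α∈ → α∉ (∈-++⁺ˡ α∈))
           (All.zipWith (λ (y<γ , γ≤y-if) → ≮⇒≥ (λ α<y → <⇒≱ y<γ (γ≤y-if α<y)))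
                        (ys<γ , AllProps.++⁻ˡ ys minimal))

-- The tableau is the single row r after reading the letters rp (most recent
-- first): r is increasing, holds exactly these letters, and after an odd
-- number of letters it ends with the most recent one.
record SingleRow (r rp : List ℕ) : Set where
  field
    sorted : AllPairs _<_ r
    perm   : r ↭ rp
    peak   : isEven (length rp) ≡ false → ∃[ ys ] r ≡ ys ++ take 1 rp

-- The condition of the theorem for the next letter a after the reversed
-- prefix rp: after an even number of letters a is a left-to-right maximum;
-- after an odd number it exceeds all of them except the most recent one.
Good : List ℕ → ℕ → Set
Good rp a = (isEven (length rp) ≡ true  → All (_≤ a) rp)
          × (isEven (length rp) ≡ false → All (_< a) (drop 1 rp))

peak-split : ∀ {r b rest} → SingleRow r (b ∷ rest) → isEven (length (b ∷ rest)) ≡ false →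
             ∃[ ys ] r ≡ ys ++ [ b ] × ys ↭ rest
peak-split {r} {b} {rest} row odd with SingleRow.peak row odd
... | ys , refl = ys , refl , subst (_↭ rest) (++-identityʳ ys) (drop-mid ys [] (SingleRow.perm row))

sorted-belowLast : ∀ {a b ys} → AllPairs _<_ (ys ++ [ b ]) → All (_< a) ys → a < b →
                   AllPairs _<_ ((ys ++ [ a ]) ++ [ b ])
sorted-belowLast {a} {b} {ys} sorted ys<a a<b =
  AllPairs.++⁺ (AllPairs.++⁺ (proj₁ (sorted-snoc⁻ ys sorted)) ([] ∷ []) (All.map (_∷ []) ys<a))
               ([] ∷ [])
               (All.map (_∷ []) (AllProps.++⁺ (All.map (λ y<a → <-trans y<a a<b) ys<a) (a<b ∷ [])))

perm-belowLast : ∀ {a b : ℕ} {ys rest} → ys ↭ rest → (ys ++ [ a ]) ++ [ b ] ↭ a ∷ b ∷ rest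
perm-belowLast {a} {b} {ys} {rest} ys↭rest = begin
  (ys ++ [ a ]) ++ [ b ] ≡⟨ ++-assoc ys [ a ] [ b ] ⟩
  ys ++ a ∷ b ∷ []       ↭⟨ ++-comm ys (a ∷ b ∷ []) ⟩
  a ∷ b ∷ ys             ↭⟨ ↭-prep a (↭-prep b ys↭rest) ⟩
  a ∷ b ∷ rest           ∎
  where open PermutationReasoning

above-good : ∀ {a r rp} → SingleRow r rp → All (_< a) r → Good rp a × SingleRow (r ++ [ a ]) (a ∷ rp)
above-good {a} {r} {rp} row r<a = good , row'
  where
  open SingleRow row
  rp<a : All (_< a) rp
  rp<a = All-resp-↭ perm r<a
  good : Good rp a
  good = (λ _ → All.map <⇒≤ rp<a) , (λ _ → drop⁺ 1 rp<a)
  row' : SingleRow (r ++ [ a ]) (a ∷ rp)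
  SingleRow.sorted row' = AllPairs.++⁺ sorted ([] ∷ []) (All.map (_∷ []) r<a)
  SingleRow.perm   row' = ↭-trans (↭-sym (∷↭∷ʳ a r)) (↭-prep a perm)
  SingleRow.peak   row' _ = r , refl

-- Putting a into the place of the last entry b, which moves one cell right.
-- This happens after an odd number of letters, so b is the latest letter.
belowLast-good : ∀ {a b ys rp} → SingleRow (ys ++ [ b ]) rp → All (_< a) ys → a < b →
                 isEven (length rp) ≡ false →
                 Good rp a × SingleRow ((ys ++ [ a ]) ++ [ b ]) (a ∷ rp)
belowLast-good {rp = []} _ _ _ ()
belowLast-good {a} {b} {ys} {c ∷ rest} row ys<a a<b rpOdd with peak-split row rpOdd
... | zs , ys++b≡zs++c , zs↭rest with ∷ʳ-injective ys zs ys++b≡zs++c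
...   | refl , refl = good , row'
  where
  good : Good (b ∷ rest) a
  good = (λ even → ⊥-elim (true≢false (trans (sym even) rpOdd))) ,
         (λ _ → All-resp-↭ zs↭rest ys<a)
  row' : SingleRow ((ys ++ [ a ]) ++ [ b ]) (a ∷ b ∷ rest)
  SingleRow.sorted row' = sorted-belowLast (SingleRow.sorted row) ys<a a<b
  SingleRow.perm   row' = perm-belowLast zs↭rest
  SingleRow.peak   row' odd =
    ⊥-elim (true≢false (trans (sym (trans (isEven-suc (length (b ∷ rest))) (cong not rpOdd))) odd))

stop-good : ∀ {a r r' rp} → SingleRow r rp → Stop a r r' → Good rp a × SingleRow r' (a ∷ rp)
stop-good row (above r<a) = above-good row r<a
stop-good row (belowLast ys<a a<b odd) =
  belowLast-good row ys<a a<b (trans (cong isEven (sym (↭-length (SingleRow.perm row)))) odd)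

good-stop : ∀ {a r rp} → SingleRow r rp → a ∉ rp → Good rp a → ∃[ r' ] Stop a r r'
good-stop {a} {r} {rp} row a∉rp (ifEven , ifOdd) with isEven (length rp) in parity
... | true = _ , above (All-resp-↭ (↭-sym (SingleRow.perm row)) (strictly-below a∉rp (ifEven refl)))
good-stop {a} {r} {[]} row a∉rp (ifEven , ifOdd) | false with () ← parity
good-stop {a} {r} {b ∷ rest} row a∉rp (ifEven , ifOdd) | false
  with peak-split row parity | <-cmp a b
... | ys , refl , ys↭rest | tri< a<b _ _ =
  _ , belowLast (All-resp-↭ (↭-sym ys↭rest) (ifOdd refl)) a<b
                (trans (cong isEven (↭-length (SingleRow.perm row))) parity)
... | _ | tri≈ _ refl _ = ⊥-elim (a∉rp (here refl))
... | _ | tri> _ _ b<a =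
  _ , above (All-resp-↭ (↭-sym (SingleRow.perm row)) (b<a ∷ ifOdd refl))

insertInto : Tableau → ℕ → Tableau
insertInto P a = schroderInsert a P

-- Insertion never removes a row, so a tableau with two rows keeps them.
insert-length : ∀ a P → length P ≤ length (schroderInsert a P)
insert-length a []      = z≤n
insert-length a (r ∷ P) with rowInsert a r
... | _ , nothing = ≤-refl
... | _ , just β  = s≤s (insert-length β P)

insertAll-length : ∀ xs P → length P ≤ length (foldl insertInto P xs)
insertAll-length []       P = ≤-refl
insertAll-length (x ∷ xs) P = ≤-trans (insert-length x P) (insertAll-length xs (insertInto P x))

-- Every letter of xs is good when it is read, rp being the letters read
-- before xs (most recent first).
Admissible : List ℕ → List ℕ → Set
Admissible rp []       = ⊤
Admissible rp (a ∷ xs) = Good rp a × Admissible (a ∷ rp) xs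

Unique-resp-↭ : ∀ {xs ys : List ℕ} → xs ↭ ys → Unique xs → Unique ys
Unique-resp-↭ p = PermSetoid.Unique-resp-↭ (setoid ℕ) (↭⇒↭ₛ p)

next-fresh : ∀ {a} rp xs → Unique (rp ++ a ∷ xs) → a ∉ rp × Unique ((a ∷ rp) ++ xs)
next-fresh {a} rp xs distinct with Unique-resp-↭ (shift a rp xs) distinct
... | distinct'@(a∉rest ∷ _) = All¬⇒¬Any (AllProps.++⁻ˡ rp a∉rest) , distinct'

readWord : ∀ {r rp} xs → SingleRow r rp → Unique (rp ++ xs) →
           length (foldl insertInto (r ∷ []) xs) ≡ 1 ⇔ Admissible rp xs
readWord []       row distinct = mk⇔ (λ _ → tt) (λ _ → refl)
readWord {r} {rp} (a ∷ xs) row distinct with next-fresh rp xs distinct | rowInsert a r in step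
... | a∉rp , distinct' | r' , nothing =
  mk⇔ (λ oneRow → proj₁ stepped , Equivalence.to rest oneRow)
      (λ (_ , admissible) → Equivalence.from rest admissible)
  where
  a∉r : a ∉ r
  a∉r a∈r = a∉rp (∈-resp-↭ (SingleRow.perm row) a∈r)
  stepped : Good rp a × SingleRow r' (a ∷ rp)
  stepped = stop-good row (stop-complete (SingleRow.sorted row) a∉r step)
  rest : length (foldl insertInto (r' ∷ []) xs) ≡ 1 ⇔ Admissible (a ∷ rp) xs
  rest = readWord xs (proj₂ stepped) distinct'
... | a∉rp , _ | r' , just β =
  mk⇔ (λ oneRow → ⊥-elim (twoRows oneRow)) (λ (good , _) → ⊥-elim (bumps good))
  where
  twoRows : length (foldl insertInto (r' ∷ schroderInsert β []) xs) ≢ 1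
  twoRows oneRow with subst (2 ≤_) oneRow (insertAll-length xs (r' ∷ schroderInsert β []))
  ... | s≤s ()
  bumps : Good rp a → ⊥
  bumps good with good-stop row a∉rp good
  ... | _ , stop with () ← trans (sym step) (stop-sound stop)

admissible⇔pointwise : ∀ rp xs →
  Admissible rp xs ⇔ ((i : Fin (length xs)) → Good (take (toℕ i) xs ʳ++ rp) (lookup xs i))
admissible⇔pointwise rp []       = mk⇔ (λ _ ()) (λ _ → tt)
admissible⇔pointwise rp (a ∷ xs) = mk⇔
  (λ { (good , admissible) zero    → good
     ; (good , admissible) (suc i) → Equivalence.to rest admissible i })
  (λ pointwise → pointwise zero , Equivalence.from rest (λ i → pointwise (suc i)))
  where
  rest : Admissible (a ∷ rp) xs ⇔ ((i : Fin (length xs)) → Good (take (toℕ i) xs ʳ++ a ∷ rp) (lookup xs i))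
  rest = admissible⇔pointwise (a ∷ rp) xs

All-take : ∀ {P : ℕ → Set} m xs → All P (take m xs) ⇔ ((j : Fin (length xs)) → toℕ j < m → P (lookup xs j))
All-take zero    xs       = mk⇔ (λ _ _ ()) (λ _ → [])
All-take (suc m) []       = mk⇔ (λ _ ()) (λ _ → [])
All-take (suc m) (x ∷ xs) = mk⇔
  (λ { (px ∷ pxs) zero    _         → px
     ; (px ∷ pxs) (suc j) (s≤s j<m) → Equivalence.to (All-take m xs) pxs j j<m })
  (λ pointwise → pointwise zero (s≤s z≤n) ∷
                 Equivalence.from (All-take m xs) (λ j j<m → pointwise (suc j) (s≤s j<m)))

All-earlier : ∀ {P : ℕ → Set} m xs →
  All P (take m xs ʳ++ []) ⇔ ((j : Fin (length xs)) → toℕ j < m → P (lookup xs j))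
All-earlier m xs = mk⇔
  (λ h → Equivalence.to (All-take m xs) (All-resp-↭ (↭-reverse (take m xs)) h))
  (λ h → All-resp-↭ (↭-sym (↭-reverse (take m xs))) (Equivalence.from (All-take m xs) h))

take-suc-ʳ++ : ∀ k (xs ys : List ℕ) → suc k ≤ length xs → ∃[ z ] take (suc k) xs ʳ++ ys ≡ z ∷ (take k xs ʳ++ ys)
take-suc-ʳ++ zero    (x ∷ xs) ys _         = x , refl
take-suc-ʳ++ (suc k) (x ∷ xs) ys (s≤s k<) = take-suc-ʳ++ k xs (x ∷ ys) k<

drop-latest : ∀ m (xs : List ℕ) → m ≤ length xs → drop 1 (take m xs ʳ++ []) ≡ take (m ∸ 1) xs ʳ++ []
drop-latest zero    xs _ = refl
drop-latest (suc k) xs k< with take-suc-ʳ++ k xs [] k<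
... | z , eq = cong (drop 1) eq

earlier-length : ∀ (xs : List ℕ) (i : Fin (length xs)) → length (take (toℕ i) xs ʳ++ []) ≡ toℕ i
earlier-length xs i = trans (length-reverse (take (toℕ i) xs))
                            (trans (length-take (toℕ i) xs) (m≤n⇒m⊓n≡m (<⇒≤ (toℕ<n i))))

-- The parity of the paper's index n + 1 of a 0-based position n.
data IndexParity (n : ℕ) : Set where
  oddIndex  : (n + 1) % 2 ≡ 1 → isEven n ≡ true  → IndexParity n
  evenIndex : (n + 1) % 2 ≡ 0 → isEven n ≡ false → IndexParity n

indexParity : ∀ n → IndexParity n
indexParity zero          = oddIndex refl refl
indexParity (suc zero)    = evenIndex refl refl
indexParity (suc (suc n)) with indexParity n
... | oddIndex  p q = oddIndex p q
... | evenIndex p q = evenIndex p q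

<∸1⇒ : ∀ {j i} → j < i ∸ 1 → j < i × j ≢ i ∸ 1
<∸1⇒ {j} {i} j<i∸1 = <-≤-trans j<i∸1 (m∸n≤m i 1) , <⇒≢ j<i∸1

⇒<∸1 : ∀ {j i} → j < i → j ≢ i ∸ 1 → j < i ∸ 1
⇒<∸1 {j} {suc i} (s≤s j≤i) j≢i = ≤∧≢⇒< j≤i j≢i

Condition : (π : List ℕ) → Fin (length π) → Set
Condition π i =
  ((toℕ i + 1) % 2 ≡ 1 → (j : Fin (length π)) → toℕ j ≤ toℕ i → lookup π j ≤ lookup π i)
  × ((toℕ i + 1) % 2 ≡ 0 → (j : Fin (length π)) → toℕ j < toℕ i → toℕ j ≢ toℕ i ∸ 1 →
       lookup π j < lookup π i)

leftToRightMax⇔ : ∀ π (i : Fin (length π)) →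
  All (_≤ lookup π i) (take (toℕ i) π ʳ++ []) ⇔ (∀ j → toℕ j ≤ toℕ i → lookup π j ≤ lookup π i)
leftToRightMax⇔ π i = mk⇔
  (λ earlier → upTo-i (Equivalence.to (All-earlier (toℕ i) π) earlier))
  (λ upTo → Equivalence.from (All-earlier (toℕ i) π) (λ j j<i → upTo j (<⇒≤ j<i)))
  where
  upTo-i : (∀ j → toℕ j < toℕ i → lookup π j ≤ lookup π i) → ∀ j → toℕ j ≤ toℕ i → lookup π j ≤ lookup π i
  upTo-i before j j≤i with m≤n⇒m<n∨m≡n j≤i
  ... | inj₁ j<i = before j j<i
  ... | inj₂ j≡i rewrite toℕ-injective j≡i = ≤-refl

leftToRightMaxButLast⇔ : ∀ π (i : Fin (length π)) →
  All (_< lookup π i) (drop 1 (take (toℕ i) π ʳ++ [])) ⇔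
  (∀ j → toℕ j < toℕ i → toℕ j ≢ toℕ i ∸ 1 → lookup π j < lookup π i)
leftToRightMaxButLast⇔ π i = mk⇔
  (λ earlier j j<i j≢ → Equivalence.to (All-earlier (toℕ i ∸ 1) π)
                          (subst (All (_< lookup π i)) dropped earlier) j (⇒<∸1 j<i j≢))
  (λ allBut → subst (All (_< lookup π i)) (sym dropped)
                (Equivalence.from (All-earlier (toℕ i ∸ 1) π)
                  (λ j j<i∸1 → let (j<i , j≢) = <∸1⇒ j<i∸1 in allBut j j<i j≢)))
  where
  dropped : drop 1 (take (toℕ i) π ʳ++ []) ≡ take (toℕ i ∸ 1) π ʳ++ []
  dropped = drop-latest (toℕ i) π (<⇒≤ (toℕ<n i))

good⇔condition : ∀ π (i : Fin (length π)) → Good (take (toℕ i) π ʳ++ []) (lookup π i) ⇔ Condition π i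
good⇔condition π i with indexParity (toℕ i) | earlier-length π i
... | oddIndex p₁ even | len = mk⇔
  (λ (ifEven , _) → (λ _ → Equivalence.to (leftToRightMax⇔ π i) (ifEven (trans (cong isEven len) even))) ,
                    (λ p₀ → ⊥-elim (1+n≢0 (trans (sym p₁) p₀))))
  (λ (maximum , _) → (λ _ → Equivalence.from (leftToRightMax⇔ π i) (maximum p₁)) ,
                     (λ odd → ⊥-elim (true≢false (trans (sym even) (trans (sym (cong isEven len)) odd)))))
... | evenIndex p₀ odd | len = mk⇔
  (λ (_ , ifOdd) → (λ p₁ → ⊥-elim (1+n≢0 (trans (sym p₁) p₀))) ,
                   (λ _ → Equivalence.to (leftToRightMaxButLast⇔ π i) (ifOdd (trans (cong isEven len) odd))))
  (λ (_ , maximumButLast) →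
     (λ even → ⊥-elim (true≢false (trans (sym even) (trans (cong isEven len) odd)))) ,
     (λ _ → Equivalence.from (leftToRightMaxButLast⇔ π i) (maximumButLast p₀)))

-- Reading starts from the empty row; on a nonempty word this is `schroderP`,
-- whose first step builds the one-cell tableau.
emptyRow : SingleRow [] []
SingleRow.sorted emptyRow = []
SingleRow.perm   emptyRow = ↭-refl
SingleRow.peak   emptyRow ()

mainTheorem6 : (n : ℕ) → 1 ≤ n → (π : List ℕ) → π ↭ map suc (upTo n) →
    (length (schroderP π) ≡ 1)
    ⇔ ((i : Fin (length π)) →
         ((toℕ i + 1) % 2 ≡ 1 →
            (j : Fin (length π)) → toℕ j ≤ toℕ i → lookup π j ≤ lookup π i)
         × ((toℕ i + 1) % 2 ≡ 0 →
            (j : Fin (length π)) → toℕ j < toℕ i → toℕ j ≢ toℕ i ∸ 1 →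
              lookup π j < lookup π i))
mainTheorem6 zero    () π π↭
mainTheorem6 (suc n) _  [] π↭
  with () ← trans (↭-length π↭) (trans (length-map suc (upTo (suc n))) (length-upTo (suc n)))
mainTheorem6 (suc n) _  π@(_ ∷ _) π↭ =
  ⇔-trans (readWord π emptyRow distinct)
  (⇔-trans (admissible⇔pointwise [] π)
           (mk⇔ (λ good i → Equivalence.to (good⇔condition π i) (good i))
                (λ cond i → Equivalence.from (good⇔condition π i) (cond i))))
  where
  distinct : Unique π
  distinct = Unique-resp-↭ (↭-sym π↭) (Unique.map⁺ suc-injective (Unique.upTo⁺ (suc n)))
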